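{- For any set $A$, the set of decidable strict total orders on $A$ and the set of decidable total orders on $A$ are equivalent.
   Context: Constructive (univalent) type theory. A total order on $A$ is a proposition-valued relation $\le$ that is reflexive, transitive, antisymmetric, and total (for all $x,y$, merely $x\le y$ or $y\le x$); it is decidable if for all $x,y$, $(x\le y)+\neg(x\le y)$. A strict total order on $A$ is a proposition-valued relation $<$ that is irreflexive ($\neg(x<x)$), transitive, asymmetric ($x<y\Rightarrow\neg(y<x)$), cotransitive (if $x<z$ then merely $x<y$ or $y<z$, for all $y$), and connected (if $\neg(x<y)$ and $\neg(y<x)$ then $x=y$); it is decidable if for all $x,y$, $(x<y)+\neg(x<y)$. -}

module Defs where

open import Level using (Level; _⊔_; suc; Setω)
open import Data.Product using (Σ)
open import Data.Sum using (_⊎_)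
open import Relation.Nullary using (¬_)
open import Relation.Binary.PropositionalEquality using (_≡_)

isProp : ∀ {ℓ} → Set ℓ → Set ℓ
isProp P = (x y : P) → x ≡ y

isSet : ∀ {ℓ} → Set ℓ → Set ℓ
isSet A = (x y : A) → isProp (x ≡ y)

FunExt : Setω
FunExt = ∀ {a b} {A : Set a} {B : A → Set b} {f g : (x : A) → B x}
         → ((x : A) → f x ≡ g x) → f ≡ g

PropExt : (r : Level) → Set (suc r)
PropExt r = (P Q : Set r) → isProp P → isProp Q → (P → Q) → (Q → P) → P ≡ Q

record PropTrunc : Setω where
  field
    ∥_∥      : ∀ {ℓ} → Set ℓ → Set ℓ
    ∣_∣      : ∀ {ℓ} {X : Set ℓ} → X → ∥ X ∥
    ∥∥-isProp : ∀ {ℓ} {X : Set ℓ} → isProp ∥ X ∥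
    ∥∥-rec   : ∀ {ℓ p} {X : Set ℓ} {P : Set p} → isProp P → (X → P) → ∥ X ∥ → P

module _ (T : PropTrunc) {a : Level} (A : Set a) (r : Level) where
  open PropTrunc T

  record IsDecTotalOrder (_≤_ : A → A → Set r) : Set (a ⊔ r) where
    field
      ≤-prop    : ∀ x y → isProp (x ≤ y)
      ≤-refl    : ∀ x → x ≤ x
      ≤-trans   : ∀ x y z → x ≤ y → y ≤ z → x ≤ z
      ≤-antisym : ∀ x y → x ≤ y → y ≤ x → x ≡ y
      ≤-total   : ∀ x y → ∥ (x ≤ y) ⊎ (y ≤ x) ∥
      ≤-dec     : ∀ x y → (x ≤ y) ⊎ ¬ (x ≤ y)

  record IsDecStrictTotalOrder (_<_ : A → A → Set r) : Set (a ⊔ r) where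
    field
      <-prop      : ∀ x y → isProp (x < y)
      <-irrefl    : ∀ x → ¬ (x < x)
      <-trans     : ∀ x y z → x < y → y < z → x < z
      <-asym      : ∀ x y → x < y → ¬ (y < x)
      <-cotrans   : ∀ x z → x < z → ∀ y → ∥ (x < y) ⊎ (y < z) ∥
      <-connected : ∀ x y → ¬ (x < y) → ¬ (y < x) → x ≡ y
      <-dec       : ∀ x y → (x < y) ⊎ ¬ (x < y)

  DecTotalOrder : Set (a ⊔ suc r)
  DecTotalOrder = Σ (A → A → Set r) IsDecTotalOrder

  DecStrictTotalOrder : Set (a ⊔ suc r)
  DecStrictTotalOrder = Σ (A → A → Set r) IsDecStrictTotalOrder

-- Complementing the converse, R ↦ λ x y → ¬ R y x, turns a decidable strict
-- total order into a decidable total order and back.  Decidability is what makes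
-- the two constructions mutually inverse: a decidable proposition is equal (by
-- propositional extensionality) to its double negation, so complementing twice
-- gives back the original relation.  Being an order of either kind is a
-- proposition when A is a set, so the relation determines the whole structure.
module Submission where

open import Defs
open import Level using (Level)
open import Axiom.UniquenessOfIdentityProofs using (module Constant⇒UIP)
open import Function.Bundles using (_↔_; mk↔ₛ′)
open import Data.Product using (Σ; _,_; proj₁)
open import Data.Sum using (_⊎_; inj₁; inj₂; [_,_]′)
open import Data.Empty using (⊥-elim)
open import Relation.Nullary using (¬_)
open import Relation.Binary.PropositionalEquality using (_≡_; refl; cong)

private
  variable
    ℓ ℓ′ ℓ″ : Level

isProp⇒isSet : {X : Set ℓ} → isProp X → isSet X
isProp⇒isSet h x y = Constant⇒UIP.≡-irrelevant (λ {u} {v} _ → h u v) (λ _ _ → refl)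

Σ≡Prop : {X : Set ℓ} {B : X → Set ℓ′} → (∀ x → isProp (B x))
       → {u v : Σ X B} → proj₁ u ≡ proj₁ v → u ≡ v
Σ≡Prop h {x , b} {.x , c} refl = cong (x ,_) (h x b c)

dec-stable : {P : Set ℓ} → P ⊎ ¬ P → ¬ ¬ P → P
dec-stable (inj₁ p)  _   = p
dec-stable (inj₂ ¬p) ¬¬p = ⊥-elim (¬¬p ¬p)

¬-dec : {P : Set ℓ} → P ⊎ ¬ P → ¬ P ⊎ ¬ ¬ P
¬-dec (inj₁ p)  = inj₂ (λ ¬p → ¬p p)
¬-dec (inj₂ ¬p) = inj₁ ¬p

module _ (fe : FunExt) where

  isPropΠ : {X : Set ℓ} {B : X → Set ℓ′} → (∀ x → isProp (B x)) → isProp ((x : X) → B x)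
  isPropΠ h f g = fe λ x → h x (f x) (g x)

  isPropΠ2 : {X : Set ℓ} {Y : Set ℓ′} {B : X → Y → Set ℓ″}
           → (∀ x y → isProp (B x y)) → isProp ((x : X) (y : Y) → B x y)
  isPropΠ2 h = isPropΠ λ x → isPropΠ (h x)

  isProp¬ : (P : Set ℓ) → isProp (¬ P)
  isProp¬ P ¬p ¬p′ = fe λ p → ⊥-elim (¬p p)

  isProp-dec : {P : Set ℓ} → isProp P → isProp (P ⊎ ¬ P)
  isProp-dec h (inj₁ p)  (inj₁ p′)  = cong inj₁ (h p p′)
  isProp-dec h (inj₁ p)  (inj₂ ¬p′) = ⊥-elim (¬p′ p)
  isProp-dec h (inj₂ ¬p) (inj₁ p′)  = ⊥-elim (¬p p′)
  isProp-dec h (inj₂ ¬p) (inj₂ ¬p′) = cong inj₂ (isProp¬ _ ¬p ¬p′)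

  ¬¬-≡ : {r : Level} → PropExt r → {P : Set r} → isProp P → P ⊎ ¬ P → (¬ ¬ P) ≡ P
  ¬¬-≡ pe h d = pe _ _ (isProp¬ _) h (dec-stable d) (λ p ¬p → ¬p p)

  module Orders (T : PropTrunc) {a r : Level} (A : Set a) where
    open PropTrunc T

    _ᶜ : (A → A → Set r) → A → A → Set r
    (R ᶜ) x y = ¬ R y x

    ᶜ-involutive : PropExt r → {R : A → A → Set r}
                 → (∀ x y → isProp (R x y)) → (∀ x y → R x y ⊎ ¬ R x y) → (R ᶜ) ᶜ ≡ R
    ᶜ-involutive pe prop dec = fe λ x → fe λ y → ¬¬-≡ pe (prop x y) (dec x y)

    strict⇒total : {_<_ : A → A → Set r}
                 → IsDecStrictTotalOrder T A r _<_ → IsDecTotalOrder T A r (_<_ ᶜ)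
    strict⇒total {_<_} o = record
      { ≤-prop    = λ x y → isProp¬ _
      ; ≤-refl    = <-irrefl
      ; ≤-trans   = λ x y z y≮x z≮y z<x →
          ∥∥-rec (λ ()) [ z≮y , y≮x ]′ (<-cotrans z x z<x y)
      ; ≤-antisym = λ x y y≮x x≮y → <-connected x y x≮y y≮x
      ; ≤-total   = λ x y → ∣ total x y (<-dec y x) ∣
      ; ≤-dec     = λ x y → ¬-dec (<-dec y x)
      }
      where
      open IsDecStrictTotalOrder o
      total : ∀ x y → (y < x) ⊎ ¬ (y < x) → ¬ (y < x) ⊎ ¬ (x < y)
      total x y (inj₁ y<x) = inj₂ (<-asym y x y<x)
      total x y (inj₂ y≮x) = inj₁ y≮x

    total⇒strict : {_≤_ : A → A → Set r}
                 → IsDecTotalOrder T A r _≤_ → IsDecStrictTotalOrder T A r (_≤_ ᶜ)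
    total⇒strict {_≤_} o = record
      { <-prop      = λ x y → isProp¬ _
      ; <-irrefl    = λ x x≰x → x≰x (≤-refl x)
      ; <-trans     = λ x y z y≰x z≰y z≤x → z≰y (≤-trans z x y z≤x (≰⇒≥ y≰x))
      ; <-asym      = λ x y y≰x x≰y → ∥∥-rec (λ ()) [ x≰y , y≰x ]′ (≤-total x y)
      ; <-cotrans   = λ x z z≰x y → ∣ cotrans z≰x (≤-dec y x) ∣
      ; <-connected = λ x y ¬y≰x ¬x≰y →
          ≤-antisym x y (dec-stable (≤-dec x y) ¬x≰y) (dec-stable (≤-dec y x) ¬y≰x)
      ; <-dec       = λ x y → ¬-dec (≤-dec y x)
      }
      where
      open IsDecTotalOrder o
      ≰⇒≥ : ∀ {x y} → ¬ (y ≤ x) → x ≤ y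
      ≰⇒≥ {x} {y} y≰x = ∥∥-rec (≤-prop x y) [ (λ x≤y → x≤y) , (λ y≤x → ⊥-elim (y≰x y≤x)) ]′ (≤-total x y)
      cotrans : ∀ {x y z} → ¬ (z ≤ x) → (y ≤ x) ⊎ ¬ (y ≤ x) → ¬ (y ≤ x) ⊎ ¬ (z ≤ y)
      cotrans z≰x (inj₁ y≤x) = inj₂ (λ z≤y → z≰x (≤-trans _ _ _ z≤y y≤x))
      cotrans z≰x (inj₂ y≰x) = inj₁ y≰x

    module _ (A-set : isSet A) (R : A → A → Set r) where

      IsDecTotalOrder-isProp : isProp (IsDecTotalOrder T A r R)
      IsDecTotalOrder-isProp o o′ = fields≡ prop≡
        (isPropΠ (λ x → P x x) _ _)
        (isPropΠ2 (λ x y → isPropΠ2 λ z _ → isPropΠ λ _ → P x z) _ _)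
        (isPropΠ2 (λ x y → isPropΠ2 λ _ _ → A-set x y) _ _)
        (isPropΠ2 (λ x y → ∥∥-isProp) _ _)
        (isPropΠ2 (λ x y → isProp-dec (P x y)) _ _)
        where
        open IsDecTotalOrder
        P : ∀ x y → isProp (R x y)
        P = ≤-prop o
        prop≡ : ≤-prop o ≡ ≤-prop o′
        prop≡ = isPropΠ2 (λ x y → isPropΠ2 (isProp⇒isSet (P x y))) _ _
        fields≡ : ≤-prop o ≡ ≤-prop o′ → ≤-refl o ≡ ≤-refl o′ → ≤-trans o ≡ ≤-trans o′
                → ≤-antisym o ≡ ≤-antisym o′ → ≤-total o ≡ ≤-total o′ → ≤-dec o ≡ ≤-dec o′ → o ≡ o′
        fields≡ refl refl refl refl refl refl = refl

      IsDecStrictTotalOrder-isProp : isProp (IsDecStrictTotalOrder T A r R)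
      IsDecStrictTotalOrder-isProp o o′ = fields≡ prop≡
        (isPropΠ (λ x → isProp¬ _) _ _)
        (isPropΠ2 (λ x y → isPropΠ2 λ z _ → isPropΠ λ _ → P x z) _ _)
        (isPropΠ2 (λ x y → isPropΠ λ _ → isProp¬ _) _ _)
        (isPropΠ2 (λ x z → isPropΠ2 λ _ y → ∥∥-isProp) _ _)
        (isPropΠ2 (λ x y → isPropΠ2 λ _ _ → A-set x y) _ _)
        (isPropΠ2 (λ x y → isProp-dec (P x y)) _ _)
        where
        open IsDecStrictTotalOrder
        P : ∀ x y → isProp (R x y)
        P = <-prop o
        prop≡ : <-prop o ≡ <-prop o′
        prop≡ = isPropΠ2 (λ x y → isPropΠ2 (isProp⇒isSet (P x y))) _ _
        fields≡ : <-prop o ≡ <-prop o′ → <-irrefl o ≡ <-irrefl o′ → <-trans o ≡ <-trans o′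
                → <-asym o ≡ <-asym o′ → <-cotrans o ≡ <-cotrans o′
                → <-connected o ≡ <-connected o′ → <-dec o ≡ <-dec o′ → o ≡ o′
        fields≡ refl refl refl refl refl refl refl = refl

    toTotal : DecStrictTotalOrder T A r → DecTotalOrder T A r
    toTotal (_<_ , o) = _<_ ᶜ , strict⇒total o

    toStrict : DecTotalOrder T A r → DecStrictTotalOrder T A r
    toStrict (_≤_ , o) = _≤_ ᶜ , total⇒strict o

    toStrict∘toTotal : isSet A → PropExt r → ∀ s → toStrict (toTotal s) ≡ s
    toStrict∘toTotal A-set pe (_ , o) = Σ≡Prop (IsDecStrictTotalOrder-isProp A-set)
      (ᶜ-involutive pe (IsDecStrictTotalOrder.<-prop o) (IsDecStrictTotalOrder.<-dec o))

    toTotal∘toStrict : isSet A → PropExt r → ∀ t → toTotal (toStrict t) ≡ t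
    toTotal∘toStrict A-set pe (_ , o) = Σ≡Prop (IsDecTotalOrder-isProp A-set)
      (ᶜ-involutive pe (IsDecTotalOrder.≤-prop o) (IsDecTotalOrder.≤-dec o))

proposition48 : (T : PropTrunc) → FunExt → {a r : Level} → PropExt r
    → (A : Set a) → isSet A
    → DecStrictTotalOrder T A r ↔ DecTotalOrder T A r
proposition48 T fe pe A A-set =
  mk↔ₛ′ toTotal toStrict (toTotal∘toStrict A-set pe) (toStrict∘toTotal A-set pe)
  where open Orders fe T A
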